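{- Let $C(m,3)=\left\lceil\frac{m-1}{3}\left\lceil\frac{m-1}{3}\right\rceil\right\rceil$. The 2-color Rado number of the equation $x_1+x_2+\cdots+x_{m-1}=3x_m$ is $C(m,3)$ for every integer $m\geq 7$. For $m=6,5,4,3$ the 2-color Rado number is, respectively, $5,4,1,9$.
   Context: For an integer $n\ge 1$ let $[n]=\{1,\ldots,n\}$. A solution of the equation in $[n]$ is an assignment of values in $[n]$ to $x_1,\ldots,x_m$ (not necessarily distinct) making the equation true; given a coloring of $[n]$, the solution is monochromatic if all the values $x_1,\ldots,x_m$ receive the same color. The 2-color Rado number of the equation is the smallest positive integer $n$ such that every coloring of $[n]$ with two colors admits a monochromatic solution in $[n]$. -}

module Defs where

open import Data.Nat using (ℕ; zero; suc; _+_; _*_; _∸_; _≤_; _<_)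
open import Data.Nat.DivMod using (_/_)
open import Data.Fin using (Fin; zero; suc)
open import Data.Bool using (Bool)
open import Data.Product using (Σ; _×_; ∃)
open import Relation.Binary.PropositionalEquality using (_≡_)
open import Relation.Nullary using (¬_)

sumFin : (k : ℕ) → (Fin k → ℕ) → ℕ
sumFin zero    f = 0
sumFin (suc k) f = f zero + sumFin k (λ i → f (suc i))

⌈_/3⌉ : ℕ → ℕ
⌈ a /3⌉ = (a + 2) / 3

InRange : ℕ → ℕ → Set
InRange n v = 1 ≤ v × v ≤ n

-- A solution in [n] of x₁ + ... + x_{m-1} = 3 x_m, with m = suc k:
-- xs are x₁..x_{m-1}, y is x_m.
record Solution (k n : ℕ) : Set where
  field
    xs    : Fin k → ℕ
    y     : ℕ
    xs∈   : (i : Fin k) → InRange n (xs i)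
    y∈    : InRange n y
    eqn   : sumFin k xs ≡ 3 * y

-- 2-colorings: only values on [n] are relevant
Coloring : Set
Coloring = ℕ → Bool

Monochromatic : {k n : ℕ} → Coloring → Solution k n → Set
Monochromatic c s = (i : Fin _) → c (Solution.xs s i) ≡ c (Solution.y s)

RadoProperty : (m n : ℕ) → Set
RadoProperty m n = (c : Coloring) → Σ (Solution (m ∸ 1) n) (Monochromatic c)

IsRadoNumber : (m r : ℕ) → Set
IsRadoNumber m r = 1 ≤ r × RadoProperty m r × ((n : ℕ) → 1 ≤ n → n < r → ¬ RadoProperty m n)

C3 : ℕ → ℕ
C3 m = ⌈ (m ∸ 1) * ⌈ m ∸ 1 /3⌉ /3⌉

-- For k ≥ 6 put t = ⌈k/3⌉ and C = ⌈kt/3⌉ = C(m,3).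
-- Lower bound (`threshold-noSolution`): colour [1, t - 1] red and [t, ∞) blue.
-- A red solution has 3y < k ≤ Σxᵢ, a blue one in [C - 1] has 3y < kt ≤ Σxᵢ.
-- Upper bound for k ≥ 7 (`UpperBound`, with k = 7 + 3u + ρ, t = 3 + u): call
-- the colour of 1 red and split on the colours of 2 and 3 and on the least
-- non-red integer of [1, t]; every case assembles a monochromatic solution
-- in [C] from sums of k terms drawn from a monochromatic interval
-- (`ColouredSums`, resting on `represent`: every s ∈ [k·lo, k·hi] is a sum
-- of k terms of [lo, hi]).
-- For m = 3, 5, 6, 7 the upper bounds are checked from decision-tree
-- certificates (each node fixes the colour of one integer, each leaf is a
-- solution monochromatic under the colours fixed above it). For m = 3, 5, 6
-- the lower bounds come from an explicit colouring and an exhaustive search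
-- showing that no 3y is a sum of k terms of y's colour; m = 7 uses the
-- threshold colouring. For m = 4, 1 + 1 + 1 = 3·1.
-- The theorem combines these facts at the end of the file.

module Submission where

open import Defs
open import Data.Bool using (Bool; true; false; if_then_else_; T)
open import Data.Bool.Properties using (¬-not) renaming (_≟_ to _≟ᴮ_)
open import Data.Empty using (⊥-elim)
open import Data.Fin using (Fin; zero; suc)
open import Data.Fin.Properties using (all?)
open import Data.List using (List; []; _∷_)
open import Data.Maybe using (Maybe; just; nothing)
open import Data.Maybe.Properties using (≡-dec; just-injective)
open import Data.Nat using (ℕ; zero; suc; _+_; _*_; _∸_; _≤_; _<_; z≤n; s≤s; s≤s⁻¹; _≡ᵇ_; _<ᵇ_; _≤?_; _≟_)
open import Data.Nat.Divisibility using (n∣m*n)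
open import Data.Nat.DivMod using (_/_; _%_; m≡m%n+[m/n]*n; m%n<n; +-distrib-/-∣ʳ; m<n⇒m/n≡0; m*n/n≡m)
open import Data.Nat.Properties
open import Data.Nat.Tactic.RingSolver using (solve-∀)
open import Data.Product using (Σ; _×_; _,_; proj₁; proj₂)
open import Data.Sum using (_⊎_; inj₁; inj₂)
open import Data.Vec using (Vec; []; _∷_; lookup)
open import Data.Vec.Functional using () renaming (_∷_ to _∷ᶠ_)
open import Function using (_∘_)
open import Relation.Binary.PropositionalEquality
open import Relation.Nullary using (¬_; Dec; yes; no; ¬?)
open import Relation.Nullary.Decidable using (True; ⌊_⌋; toWitness; fromWitness; _×-dec_; T?)

≤-from-sum : ∀ {a d b} → a + d ≡ b → a ≤ b
≤-from-sum {a} {d} refl = m≤m+n a d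

endpoints : ∀ {lo v} → lo ≤ v → v ≤ suc lo → v ≡ lo ⊎ v ≡ suc lo
endpoints lo≤v v≤1+lo with m≤n⇒m<n∨m≡n v≤1+lo
... | inj₁ v<1+lo = inj₁ (≤-antisym (s≤s⁻¹ v<1+lo) lo≤v)
... | inj₂ v≡1+lo = inj₂ v≡1+lo

divMod3 : ∀ n → n % 3 ≤ 2 × n ≡ n % 3 + 3 * (n / 3)
divMod3 n = s≤s⁻¹ (m%n<n n 3) , trans (m≡m%n+[m/n]*n n 3) (cong (n % 3 +_) (*-comm (n / 3) 3))

[e+q*3]/3≡q : ∀ e q → e < 3 → (e + q * 3) / 3 ≡ q
[e+q*3]/3≡q e q e<3 = trans (+-distrib-/-∣ʳ e (n∣m*n q)) (cong₂ _+_ (m<n⇒m/n≡0 e<3) (m*n/n≡m q 3))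

ceil3-bounds : ∀ a → a ≤ 3 * ⌈ a /3⌉ × 3 * ⌈ a /3⌉ ≤ a + 2
ceil3-bounds a =
  +-cancelʳ-≤ 2 a (3 * q) (≤-trans (≤-reflexive a+2≡e+3q) (≤-trans (+-monoˡ-≤ (3 * q) e≤2) (≤-reflexive (+-comm 2 (3 * q)))))
  , ≤-trans (m≤n+m (3 * q) ((a + 2) % 3)) (≤-reflexive (sym a+2≡e+3q))
  where
    q : ℕ
    q = ⌈ a /3⌉
    e≤2 : (a + 2) % 3 ≤ 2
    e≤2 = proj₁ (divMod3 (a + 2))
    a+2≡e+3q : a + 2 ≡ (a + 2) % 3 + 3 * q
    a+2≡e+3q = proj₂ (divMod3 (a + 2))

ceil3-summands : ∀ u ρ → ρ ≤ 2 → ⌈ 7 + (3 * u + ρ) /3⌉ ≡ 3 + u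
ceil3-summands u ρ ρ≤2 = trans (cong (_/ 3) (identity u ρ)) ([e+q*3]/3≡q ρ (3 + u) (s≤s ρ≤2))
  where identity : ∀ u ρ → 7 + (3 * u + ρ) + 2 ≡ ρ + (3 + u) * 3
        identity = solve-∀

sumFin-≥ : ∀ k {lo} (xs : Fin k → ℕ) → (∀ i → lo ≤ xs i) → k * lo ≤ sumFin k xs
sumFin-≥ zero    xs lo≤ = z≤n
sumFin-≥ (suc k) xs lo≤ = +-mono-≤ (lo≤ zero) (sumFin-≥ k (xs ∘ suc) (lo≤ ∘ suc))

sumFin-odd : ∀ k (f : Fin k → ℕ) → sumFin k (λ i → 1 + 2 * f i) ≡ 2 * sumFin k f + k
sumFin-odd zero    f = refl
sumFin-odd (suc k) f = begin
  1 + 2 * f zero + sumFin k (λ i → 1 + 2 * f (suc i)) ≡⟨ cong (1 + 2 * f zero +_) (sumFin-odd k (f ∘ suc)) ⟩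
  1 + 2 * f zero + (2 * sumFin k (f ∘ suc) + k)         ≡⟨ regroup (f zero) (sumFin k (f ∘ suc)) k ⟩
  2 * (f zero + sumFin k (f ∘ suc)) + suc k             ∎
  where
    open ≡-Reasoning
    regroup : ∀ a s k → 1 + 2 * a + (2 * s + k) ≡ 2 * (a + s) + suc k
    regroup = solve-∀

record Representation (k lo hi s : ℕ) : Set where
  field
    parts  : Fin k → ℕ
    bounds : ∀ i → lo ≤ parts i × parts i ≤ hi
    total  : sumFin k parts ≡ s

prependPart : ∀ {k lo hi s} x → lo ≤ x → x ≤ hi → Representation k lo hi s
            → Representation (suc k) lo hi (x + s)
prependPart x lo≤x x≤hi rep = record
  { parts  = x ∷ᶠ parts
  ; bounds = λ { zero → lo≤x , x≤hi ; (suc i) → bounds i }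
  ; total  = cong (x +_) total }
  where open Representation rep

-- Every s ∈ [k·lo, k·hi] is a sum of k terms of [lo, hi]: take the first
-- term as small as the remaining k - 1 terms allow.
represent : ∀ k {lo hi s} → lo ≤ hi → k * lo ≤ s → s ≤ k * hi → Representation k lo hi s
represent zero    lo≤hi _ s≤0 =
  record { parts = λ () ; bounds = λ () ; total = sym (n≤0⇒n≡0 s≤0) }
represent (suc k) {lo} {hi} {s} lo≤hi lower upper with s ≤? lo + k * hi
... | yes s≤ = subst (Representation (suc k) lo hi) (m+[n∸m]≡n (m+n≤o⇒m≤o lo lower))
                 (prependPart lo ≤-refl lo≤hi (represent k lo≤hi rest-lower (m≤n+o⇒m∸n≤o s lo s≤)))
  where rest-lower : k * lo ≤ s ∸ lo
        rest-lower = m+n≤o⇒m≤o∸n (k * lo) (subst (_≤ s) (+-comm lo (k * lo)) lower)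
... | no s≰ = subst (Representation (suc k) lo hi) (m∸n+n≡m (m+n≤o⇒n≤o lo big))
                (prependPart (s ∸ k * hi) (m+n≤o⇒m≤o∸n lo big) first≤hi
                  (represent k lo≤hi (*-monoʳ-≤ k lo≤hi) ≤-refl))
  where big : lo + k * hi ≤ s
        big = <⇒≤ (≰⇒> s≰)
        first≤hi : s ∸ k * hi ≤ hi
        first≤hi = m≤n+o⇒m∸n≤o s (k * hi) (subst (s ≤_) (+-comm hi (k * hi)) upper)

record ThirdSplit (K P : ℕ) : Set where
  field
    x y    : ℕ
    x≤K    : x ≤ K
    K≤x+2  : K ≤ x + 2
    x+P≡3y : x + P ≡ 3 * y

thirdSplit : ∀ K P → 2 ≤ K → ThirdSplit K P
thirdSplit K P 2≤K = record
  { x = K ∸ e ; y = y ; x≤K = m∸n≤m K e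
  ; K≤x+2 = ≤-trans (≤-reflexive (sym x+e≡K)) (+-monoʳ-≤ (K ∸ e) e≤2)
  ; x+P≡3y = +-cancelʳ-≡ e _ _ (begin
      K ∸ e + P + e   ≡⟨ swap (K ∸ e) P e ⟩
      K ∸ e + e + P   ≡⟨ cong (_+ P) x+e≡K ⟩
      K + P           ≡⟨ proj₂ (divMod3 (K + P)) ⟩
      e + 3 * y       ≡⟨ +-comm e (3 * y) ⟩
      3 * y + e       ∎) }
  where
    open ≡-Reasoning
    e y : ℕ
    e = (K + P) % 3
    y = (K + P) / 3
    e≤2 : e ≤ 2
    e≤2 = proj₁ (divMod3 (K + P))
    x+e≡K : K ∸ e + e ≡ K
    x+e≡K = m∸n+n≡m (≤-trans e≤2 2≤K)
    swap : ∀ x P e → x + P + e ≡ x + e + P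
    swap = solve-∀

record FirstOther (c : Coloring) (b : Bool) (N : ℕ) : Set where
  constructor firstOther
  field
    a      : ℕ
    1≤a    : 1 ≤ a
    a≤N    : a ≤ N
    other  : c a ≢ b
    before : ∀ v → 1 ≤ v → v < a → c v ≡ b

findFirstOther : ∀ c b N → (∀ v → 1 ≤ v → v ≤ N → c v ≡ b) ⊎ FirstOther c b N
findFirstOther c b zero = inj₁ λ { (suc v) _ () }
findFirstOther c b (suc N) with findFirstOther c b N
... | inj₂ (firstOther a 1≤a a≤N other before) = inj₂ (firstOther a 1≤a (m≤n⇒m≤1+n a≤N) other before)
... | inj₁ upToN with c (suc N) ≟ᴮ b
...   | no  other = inj₂ (firstOther (suc N) (s≤s z≤n) ≤-refl other λ v 1≤v v≤N → upToN v 1≤v (s≤s⁻¹ v≤N))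
...   | yes same  = inj₁ upToSucN
  where upToSucN : ∀ v → 1 ≤ v → v ≤ suc N → c v ≡ b
        upToSucN v 1≤v v≤1+N with m≤n⇒m<n∨m≡n v≤1+N
        ... | inj₁ v<1+N = upToN v 1≤v (s≤s⁻¹ v<1+N)
        ... | inj₂ refl  = same

module ColouredSums (n : ℕ) (c : Coloring) where

  record ColouredSum (j s : ℕ) (b : Bool) : Set where
    field
      terms    : Fin j → ℕ
      inRange  : ∀ i → InRange n (terms i)
      coloured : ∀ i → c (terms i) ≡ b
      total    : sumFin j terms ≡ s

  toSolution : ∀ {k s y} → InRange n y → s ≡ 3 * y → ColouredSum k s (c y)
             → Σ (Solution k n) (Monochromatic c)
  toSolution {y = y} y∈ s≡3y sum =
    record { xs = terms ; y = y ; xs∈ = inRange ; y∈ = y∈ ; eqn = trans total s≡3y } , coloured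
    where open ColouredSum sum

  prepend : ∀ {j s b} x → InRange n x → c x ≡ b → ColouredSum j s b → ColouredSum (suc j) (x + s) b
  prepend x x∈ cx sum = record
    { terms    = x ∷ᶠ terms
    ; inRange  = λ { zero → x∈ ; (suc i) → inRange i }
    ; coloured = λ { zero → cx ; (suc i) → coloured i }
    ; total    = cong (x +_) total }
    where open ColouredSum sum

  fromInterval : ∀ j {s b} lo hi → 1 ≤ lo → lo ≤ hi → hi ≤ n → j * lo ≤ s → s ≤ j * hi
               → (∀ v → lo ≤ v → v ≤ hi → c v ≡ b) → ColouredSum j s b
  fromInterval j lo hi 1≤lo lo≤hi hi≤n lower upper colour = record
    { terms    = parts
    ; inRange  = λ i → ≤-trans 1≤lo (proj₁ (bounds i)) , ≤-trans (proj₂ (bounds i)) hi≤n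
    ; coloured = λ i → colour (parts i) (proj₁ (bounds i)) (proj₂ (bounds i))
    ; total    = total }
    where open Representation (represent j lo≤hi lower upper)

  -- If 1 and 3 have colour b, then 2s + j (s ≤ j) is a coloured sum of j
  -- terms from {1, 3}: s threes and j - s ones.
  fromOnesAndThrees : ∀ j s {b} → 3 ≤ n → c 1 ≡ b → c 3 ≡ b → s ≤ j → ColouredSum j (2 * s + j) b
  fromOnesAndThrees j s {b} 3≤n c1 c3 s≤j = record
    { terms    = λ i → 1 + 2 * parts i
    ; inRange  = λ i → s≤s z≤n , ≤-trans (s≤s (*-monoʳ-≤ 2 (proj₂ (bounds i)))) 3≤n
    ; coloured = coloured
    ; total    = trans (sumFin-odd j parts) (cong (λ z → 2 * z + j) total) }
    where
      open Representation (represent j {0} {1} {s} z≤n (subst (_≤ s) (sym (*-zeroʳ j)) z≤n)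
                                       (≤-trans s≤j (≤-reflexive (sym (*-identityʳ j)))))
      coloured : ∀ i → c (1 + 2 * parts i) ≡ b
      coloured i with parts i | proj₂ (bounds i)
      ... | zero        | _ = c1
      ... | suc zero    | _ = c3
      ... | suc (suc _) | s≤s ()

threshold : ℕ → Coloring
threshold t v = v <ᵇ t

3y<a : ∀ y a → 3 * suc y ≤ a + 2 → 3 * y < a
3y<a y a h = +-cancelʳ-≤ 2 (suc (3 * y)) a (≤-trans (≤-reflexive (shift y)) h)
  where shift : ∀ y → suc (3 * y) + 2 ≡ 3 * suc y
        shift = solve-∀

-- Lower bound: if 3t ≤ k + 2 and 3C ≤ kt + 2, the threshold colouring at t
-- has no monochromatic solution in [n] for n < C. A red solution has
-- 3y < k ≤ Σxᵢ, a blue one has Σxᵢ ≥ kt > 3y.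
threshold-noSolution : ∀ k t C n → 3 * t ≤ k + 2 → 3 * C ≤ k * t + 2 → n < C → ¬ RadoProperty (suc k) n
threshold-noSolution k t C n 3t≤k+2 3C≤kt+2 n<C rado with rado (threshold t)
... | s , mono with Solution.y s <ᵇ t in y-colour
... | true  = <-irrefl (sym eqn) (≤-trans (3y<a y k (≤-trans (*-monoʳ-≤ 3 y<t) 3t≤k+2)) k≤sum)
  where
    open Solution s
    y<t : y < t
    y<t = <ᵇ⇒< y t (subst T (sym y-colour) _)
    k≤sum : k ≤ sumFin k xs
    k≤sum = subst (_≤ sumFin k xs) (*-identityʳ k) (sumFin-≥ k xs (proj₁ ∘ xs∈))
... | false = <-irrefl (sym eqn) (≤-trans (3y<a y (k * t) 3[y+1]≤kt+2) kt≤sum)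
  where
    open Solution s
    3[y+1]≤kt+2 : 3 * suc y ≤ k * t + 2
    3[y+1]≤kt+2 = ≤-trans (*-monoʳ-≤ 3 (≤-trans (s≤s (proj₂ y∈)) n<C)) 3C≤kt+2
    t≤ : ∀ i → t ≤ xs i
    t≤ i = ≮⇒≥ λ xᵢ<t → subst T (mono i) (<⇒<ᵇ xᵢ<t)
    kt≤sum : k * t ≤ sumFin k xs
    kt≤sum = sumFin-≥ k xs t≤

-- Upper bound for k = 7 + 3u + ρ summands (ρ ≤ 2), so that t = ⌈k/3⌉ = 3 + u,
-- and C with kt ≤ 3C ≤ kt + 2: every colouring c of [C] has a monochromatic
-- solution. Call the colour of 1 red.
module UpperBound (u ρ C : ℕ) (ρ≤2 : ρ ≤ 2)
                  (C-lower : (7 + (3 * u + ρ)) * (3 + u) ≤ 3 * C)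
                  (C-upper : 3 * C ≤ (7 + (3 * u + ρ)) * (3 + u) + 2)
                  (c : Coloring) where

  open ColouredSums C c

  -- k is written K; t = ⌈k/3⌉.
  r K t : ℕ
  r = 3 * u + ρ
  K = 7 + r
  t = 3 + u

  Result : Set
  Result = Σ (Solution K C) (Monochromatic c)

  red : Bool
  red = c 1

  t≤K : t ≤ K
  t≤K = ≤-from-sum (identity u ρ)
    where identity : ∀ u ρ → 3 + u + (4 + (2 * u + ρ)) ≡ 7 + (3 * u + ρ)
          identity = solve-∀

  K≤3t : K ≤ 3 * t
  K≤3t = ≤-trans (+-monoʳ-≤ (7 + 3 * u) ρ≤2) (≤-reflexive (identity u))
    where identity : ∀ u → 7 + 3 * u + 2 ≡ 3 * (3 + u)
          identity = solve-∀

  K≤C : K ≤ C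
  K≤C = *-cancelˡ-≤ 3 (≤-trans (≤-reflexive (*-comm 3 K)) (≤-trans (*-monoʳ-≤ K (m≤m+n 3 u)) C-lower))

  inRange : ∀ {v} → 1 ≤ v → v ≤ K → InRange C v
  inRange 1≤v v≤K = 1≤v , ≤-trans v≤K K≤C

  solution : ∀ y → InRange C y → ColouredSum K (3 * y) (c y) → Result
  solution y y∈ = toSolution y∈ refl

  bothOther : ∀ {v w} → c v ≢ red → c w ≢ red → c v ≡ c w
  bothOther nv nw = trans (¬-not nv) (sym (¬-not nw))

  -- If [1, h] is red and w ∈ [k - 2, (k - 2)h] is red, then
  -- w + w + (k - 2 terms of [1, h] summing to w) = 3w.
  twiceRed : ∀ h w → 1 ≤ h → h ≤ C → (∀ v → 1 ≤ v → v ≤ h → c v ≡ red)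
           → InRange C w → 5 + r ≤ w → w ≤ (5 + r) * h → c w ≡ red → Result
  twiceRed h w 1≤h h≤C redBelow w∈ lower upper cw =
    toSolution w∈ (sum≡ w) (prepend w w∈ refl (prepend w w∈ refl
      (fromInterval (5 + r) 1 h ≤-refl 1≤h h≤C (≤-trans (≤-reflexive (*-identityʳ (5 + r))) lower) upper
                    λ v 1≤v v≤h → trans (redBelow v 1≤v v≤h) (sym cw))))
    where sum≡ : ∀ w → w + (w + w) ≡ 3 * w
          sum≡ = solve-∀

  notRedOn23 : c 2 ≢ red → c 3 ≢ red → ∀ v → 2 ≤ v → v ≤ 3 → c v ≢ red
  notRedOn23 n2 n3 v 2≤v v≤3 with endpoints 2≤v v≤3
  ... | inj₁ refl = n2
  ... | inj₂ refl = n3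

  -- Case 2 and 3 not red. Then k or k - 1, if not red, is a third of a sum
  -- of k terms from {2, 3}; otherwise k + (k - 1) + (k - 2)·1 = 3(k - 1).
  twoThreeOther : c 2 ≢ red → c 3 ≢ red → Result
  twoThreeOther n2 n3 with c K ≟ᴮ red | c (6 + r) ≟ᴮ red
  ... | no nK | _ = solution K (inRange (s≤s z≤n) ≤-refl)
      (fromInterval K 2 3 (s≤s z≤n) (s≤s (s≤s z≤n)) (≤-trans (s≤s (s≤s (s≤s z≤n))) K≤C)
                    (≤-from-sum (identity r)) (≤-reflexive (*-comm 3 K)) (λ v 2≤v v≤3 → bothOther (notRedOn23 n2 n3 v 2≤v v≤3) nK))
    where identity : ∀ r → (7 + r) * 2 + (7 + r) ≡ 3 * (7 + r)
          identity = solve-∀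
  ... | yes _ | no nK1 = solution (6 + r) (inRange (s≤s z≤n) (n≤1+n _))
      (fromInterval K 2 3 (s≤s z≤n) (s≤s (s≤s z≤n)) (≤-trans (s≤s (s≤s (s≤s z≤n))) K≤C)
                    (≤-from-sum (lower r)) (≤-from-sum (upper r)) (λ v 2≤v v≤3 → bothOther (notRedOn23 n2 n3 v 2≤v v≤3) nK1))
    where lower : ∀ r → (7 + r) * 2 + (4 + r) ≡ 3 * (6 + r)
          lower = solve-∀
          upper : ∀ r → 3 * (6 + r) + 3 ≡ (7 + r) * 3
          upper = solve-∀
  ... | yes redK | yes redK1 = toSolution (inRange (s≤s z≤n) (n≤1+n _)) (sum≡ r)
      (prepend K (inRange (s≤s z≤n) ≤-refl) (trans redK (sym redK1))
        (prepend (6 + r) (inRange (s≤s z≤n) (n≤1+n _)) refl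
          (fromInterval (5 + r) 1 1 ≤-refl ≤-refl (≤-trans (s≤s z≤n) K≤C)
                        (≤-reflexive (*-identityʳ _)) (≤-reflexive (sym (*-identityʳ _)))
                        λ v 1≤v v≤1 → trans (cong c (≤-antisym v≤1 1≤v)) (sym redK1))))
    where sum≡ : ∀ r → 7 + r + (6 + r + (5 + r)) ≡ 3 * (6 + r)
          sum≡ = solve-∀

  -- Case 2 not red, 3 red. If y = k - 4 or y = k - 2 is red, 3y = 2s + k is
  -- a sum of k ones and threes; otherwise (k - 4) + (k - 1)·2 = 3(k - 2).
  twoOther3Red : c 2 ≢ red → c 3 ≡ red → Result
  twoOther3Red n2 red3 with c (3 + r) ≟ᴮ red | c (5 + r) ≟ᴮ red
  ... | yes redQ | _ = toSolution (inRange (s≤s z≤n) (≤-from-sum (below r))) (sum≡ r)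
      (fromOnesAndThrees K (1 + r) (≤-trans (s≤s (s≤s (s≤s z≤n))) K≤C) (sym redQ) (trans red3 (sym redQ)) (≤-from-sum (count r)))
    where below : ∀ r → 3 + r + 4 ≡ 7 + r
          below = solve-∀
          count : ∀ r → 1 + r + 6 ≡ 7 + r
          count = solve-∀
          sum≡ : ∀ r → 2 * (1 + r) + (7 + r) ≡ 3 * (3 + r)
          sum≡ = solve-∀
  ... | no _ | yes redK2 = toSolution (inRange (s≤s z≤n) (≤-from-sum (below r))) (sum≡ r)
      (fromOnesAndThrees K (4 + r) (≤-trans (s≤s (s≤s (s≤s z≤n))) K≤C) (sym redK2) (trans red3 (sym redK2)) (≤-from-sum (count r)))
    where below : ∀ r → 5 + r + 2 ≡ 7 + r
          below = solve-∀
          count : ∀ r → 4 + r + 3 ≡ 7 + r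
          count = solve-∀
          sum≡ : ∀ r → 2 * (4 + r) + (7 + r) ≡ 3 * (5 + r)
          sum≡ = solve-∀
  ... | no nQ | no nK2 = toSolution (inRange (s≤s z≤n) (≤-from-sum (below5 r))) (sum≡ r)
      (prepend (3 + r) (inRange (s≤s z≤n) (≤-from-sum (below3 r))) (bothOther nQ nK2)
        (fromInterval (6 + r) 2 2 (s≤s z≤n) ≤-refl (≤-trans (s≤s (s≤s z≤n)) K≤C) ≤-refl ≤-refl
                      λ v 2≤v v≤2 → trans (cong c (≤-antisym v≤2 2≤v)) (bothOther n2 nK2)))
    where below3 : ∀ r → 3 + r + 4 ≡ 7 + r
          below3 = solve-∀
          below5 : ∀ r → 5 + r + 2 ≡ 7 + r
          below5 = solve-∀
          sum≡ : ∀ r → 3 + r + (6 + r) * 2 ≡ 3 * (5 + r)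
          sum≡ = solve-∀

  -- Case [1, t] all red: 3t is a sum of k terms from {1, 2}.
  redUpToT : (∀ v → 1 ≤ v → v ≤ t → c v ≡ red) → Result
  redUpToT redUpTo = solution t (inRange (s≤s z≤n) t≤K)
    (fromInterval K 1 2 ≤-refl (s≤s z≤n) (≤-trans (s≤s (s≤s z≤n)) (≤-trans t≤K K≤C))
                  (≤-trans (≤-reflexive (*-identityʳ K)) K≤3t) (≤-from-sum (upper u ρ))
                  λ v 1≤v v≤2 → trans (redUpTo v 1≤v (≤-trans v≤2 (s≤s (s≤s z≤n))))
                                      (sym (redUpTo t (s≤s z≤n) ≤-refl)))
    where upper : ∀ u ρ → 3 * (3 + u) + (5 + (3 * u + 2 * ρ)) ≡ (7 + (3 * u + ρ)) * 2
          upper = solve-∀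

  1+t≤K : 1 + t ≤ K
  1+t≤K = ≤-from-sum (identity u ρ)
    where identity : ∀ u ρ → 4 + u + (3 + (2 * u + ρ)) ≡ 7 + (3 * u + ρ)
          identity = solve-∀

  -- If t + 1 is red, 3(t + 1) is a sum of k
  -- terms of [1, t - 1]; else if C is not red, 3C is a sum of k terms from
  -- {t, t + 1}; else C is red and `twiceRed` applies to C.
  firstOtherAtT : (∀ v → 1 ≤ v → v < t → c v ≡ red) → c t ≢ red → Result
  firstOtherAtT redBelow nt with c (1 + t) ≟ᴮ red | c C ≟ᴮ red
  ... | yes red4 | _ = solution (1 + t) (inRange (s≤s z≤n) 1+t≤K)
      (fromInterval K 1 (2 + u) ≤-refl (s≤s z≤n) (≤-trans (n≤1+n _) (≤-trans t≤K K≤C))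
                    (≤-trans (≤-reflexive (*-identityʳ K)) (≤-trans K≤3t (*-monoʳ-≤ 3 (n≤1+n t))))
                    (≤-from-sum (upper u ρ))
                    λ v 1≤v v≤2+u → trans (redBelow v 1≤v (s≤s v≤2+u)) (sym red4))
    where upper : ∀ u ρ → 3 * (4 + u) + (2 + (10 * u + (3 * (u * u) + (2 * ρ + ρ * u)))) ≡ (7 + (3 * u + ρ)) * (2 + u)
          upper = solve-∀
  ... | no n4 | no nC = solution C (≤-trans (s≤s z≤n) K≤C , ≤-refl)
      (fromInterval K t (1 + t) (s≤s z≤n) (n≤1+n t) (≤-trans 1+t≤K K≤C) C-lower
                    (≤-trans C-upper (≤-from-sum (upper r u))) notRedOnT)
    where
      upper : ∀ r u → (7 + r) * (3 + u) + 2 + (5 + r) ≡ (7 + r) * (4 + u)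
      upper = solve-∀
      notRedOnT : ∀ v → t ≤ v → v ≤ 1 + t → c v ≡ c C
      notRedOnT v t≤v v≤1+t with endpoints t≤v v≤1+t
      ... | inj₁ refl = bothOther nt nC
      ... | inj₂ refl = bothOther n4 nC
  ... | no _ | yes redC = twiceRed (2 + u) C (s≤s z≤n) (≤-trans (n≤1+n _) (≤-trans t≤K K≤C))
      (λ v 1≤v v≤2+u → redBelow v 1≤v (s≤s v≤2+u)) (≤-trans (s≤s z≤n) K≤C , ≤-refl)
      (≤-trans (m≤n+m (5 + r) 2) K≤C) (*-cancelˡ-≤ 3 (≤-trans C-upper (≤-from-sum (upper r u)))) redC
    where upper : ∀ r u → (7 + r) * (3 + u) + 2 + (7 + (8 * u + (3 * r + 2 * (r * u)))) ≡ 3 * ((5 + r) * (2 + u))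
          upper = solve-∀

  -- Case [1, a - 1] red, a = 3 + b < t not red. With P = (k - 1)a, choose
  -- x ∈ [k - 2, k] and y with x + P = 3y. If x or y is red, `twiceRed`
  -- applies to it; otherwise x + (k - 1)·a = 3y is monochromatic.
  firstOtherBelowT : ∀ b → b < u → (∀ v → 1 ≤ v → v < 3 + b → c v ≡ red) → c (3 + b) ≢ red → Result
  firstOtherBelowT b b<u redBelow na = byColours (c x ≟ᴮ red) (c y ≟ᴮ red)
    where
      P : ℕ
      P = (6 + r) * (3 + b)
      open ThirdSplit (thirdSplit K P (s≤s (s≤s z≤n)))

      3y≤P+K : 3 * y ≤ P + K
      3y≤P+K = ≤-trans (≤-reflexive (sym x+P≡3y)) (≤-trans (+-monoˡ-≤ P x≤K) (≤-reflexive (+-comm K P)))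

      P+K≤3y+2 : P + K ≤ 3 * y + 2
      P+K≤3y+2 = ≤-trans (+-monoʳ-≤ P K≤x+2) (≤-reflexive (trans (regroup P x) (cong (_+ 2) x+P≡3y)))
        where regroup : ∀ P x → P + (x + 2) ≡ x + P + 2
              regroup = solve-∀

      x-lower : 5 + r ≤ x
      x-lower = +-cancelʳ-≤ 2 (5 + r) x (≤-trans (≤-reflexive (identity r)) K≤x+2)
        where identity : ∀ r → 5 + r + 2 ≡ 7 + r
              identity = solve-∀

      x-upper : x ≤ (5 + r) * (2 + b)
      x-upper = ≤-trans x≤K (≤-trans (≤-from-sum (identity r)) (*-monoʳ-≤ (5 + r) (m≤m+n 2 b)))
        where identity : ∀ r → 7 + r + (3 + r) ≡ (5 + r) * 2
              identity = solve-∀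

      y-lower : 5 + r ≤ y
      y-lower = *-cancelˡ-≤ 3 (+-cancelʳ-≤ 2 _ _ (≤-trans (≤-from-sum (identity r b)) P+K≤3y+2))
        where identity : ∀ r b → 3 * (5 + r) + 2 + (8 + (6 * b + (r + r * b))) ≡ (6 + r) * (3 + b) + (7 + r)
              identity = solve-∀

      y-upper : y ≤ (5 + r) * (2 + b)
      y-upper = *-cancelˡ-≤ 3 (≤-trans 3y≤P+K (≤-from-sum (identity r b)))
        where identity : ∀ r b → (6 + r) * (3 + b) + (7 + r) + (5 + (9 * b + (2 * r + 2 * (r * b)))) ≡ 3 * ((5 + r) * (2 + b))
              identity = solve-∀

      y≤C : y ≤ C
      y≤C = *-cancelˡ-≤ 3 (≤-trans 3y≤P+K (≤-trans (+-monoˡ-≤ K (*-monoʳ-≤ (6 + r) (+-monoʳ-≤ 2 b<u)))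
                                            (≤-trans (≤-from-sum (identity r u)) C-lower)))
        where identity : ∀ r u → (6 + r) * (2 + u) + (7 + r) + (2 + u) ≡ (7 + r) * (3 + u)
              identity = solve-∀

      a≤C : 3 + b ≤ C
      a≤C = ≤-trans (+-monoʳ-≤ 3 (<⇒≤ b<u)) (≤-trans t≤K K≤C)

      x∈ : InRange C x
      x∈ = inRange (≤-trans (s≤s z≤n) x-lower) x≤K

      y∈ : InRange C y
      y∈ = ≤-trans (s≤s z≤n) y-lower , y≤C

      redUpTo : ∀ v → 1 ≤ v → v ≤ 2 + b → c v ≡ red
      redUpTo v 1≤v v≤2+b = redBelow v 1≤v (s≤s v≤2+b)

      byColours : Dec (c x ≡ red) → Dec (c y ≡ red) → Result
      byColours (yes redX) _ = twiceRed (2 + b) x (s≤s z≤n) (≤-trans (n≤1+n _) a≤C) redUpTo x∈ x-lower x-upper redX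
      byColours (no _) (yes redY) = twiceRed (2 + b) y (s≤s z≤n) (≤-trans (n≤1+n _) a≤C) redUpTo y∈ y-lower y-upper redY
      byColours (no nX) (no nY) = toSolution y∈ x+P≡3y (prepend x x∈ (bothOther nX nY)
        (fromInterval (6 + r) (3 + b) (3 + b) (s≤s z≤n) ≤-refl a≤C ≤-refl ≤-refl
                      λ v a≤v v≤a → trans (cong c (≤-antisym v≤a a≤v)) (bothOther na nY)))

  twoRed : c 2 ≡ red → Result
  twoRed red2 with findFirstOther c red t
  ... | inj₁ redUpTo = redUpToT redUpTo
  ... | inj₂ (firstOther 1 _ _ other _) = ⊥-elim (other refl)
  ... | inj₂ (firstOther 2 _ _ other _) = ⊥-elim (other red2)
  ... | inj₂ (firstOther (suc (suc (suc b))) _ a≤t other before) with m≤n⇒m<n∨m≡n (s≤s⁻¹ (s≤s⁻¹ (s≤s⁻¹ a≤t)))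
  ...   | inj₁ b<u  = firstOtherBelowT b b<u before other
  ...   | inj₂ refl = firstOtherAtT before other

  monochromatic : Result
  monochromatic with c 2 ≟ᴮ red | c 3 ≟ᴮ red
  ... | yes red2 | _       = twoRed red2
  ... | no n2    | yes red3 = twoOther3Red n2 red3
  ... | no n2    | no n3    = twoThreeOther n2 n3

-- A partial colouring, as a list of (integer, colour) pairs; the first
-- pair mentioning an integer wins.
Assignment : Set
Assignment = List (ℕ × Bool)

colourIn : Assignment → ℕ → Maybe Bool
colourIn []            v = nothing
colourIn ((w , b) ∷ ρ) v = if v ≡ᵇ w then just b else colourIn ρ v

Extends : Coloring → Assignment → Set
Extends c ρ = ∀ v b → colourIn ρ v ≡ just b → c v ≡ b

extends-∷ : ∀ {c ρ} v → Extends c ρ → Extends c ((v , c v) ∷ ρ)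
extends-∷ {c} v ext w b eq with w ≡ᵇ v in w≡ᵇv
... | true  = trans (cong c (≡ᵇ⇒≡ w v (subst T (sym w≡ᵇv) _))) (just-injective eq)
... | false = ext w b eq

extends-agree : ∀ {c ρ x y} → Extends c ρ → colourIn ρ y ≢ nothing
              → colourIn ρ x ≡ colourIn ρ y → c x ≡ c y
extends-agree {ρ = ρ} {y = y} ext fixed same with colourIn ρ y in y-colour
... | nothing = ⊥-elim (fixed refl)
... | just b  = trans (ext _ b same) (sym (ext y b y-colour))

-- A certificate that every colouring of [n] has a monochromatic solution
-- of x₁ + ⋯ + x_k = 3y: a binary tree splitting on the colour of one
-- integer per node, whose leaves are candidate solutions.
data Certificate (k : ℕ) : Set where
  solved : Vec ℕ k → ℕ → Certificate k
  split  : ℕ → Certificate k → Certificate k → Certificate k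

SolvedUnder : ∀ {k} → ℕ → Assignment → Vec ℕ k → ℕ → Set
SolvedUnder {k} n ρ xs y =
  InRange n y × colourIn ρ y ≢ nothing × sumFin k (lookup xs) ≡ 3 * y
  × (∀ i → InRange n (lookup xs i) × colourIn ρ (lookup xs i) ≡ colourIn ρ y)

-- SolvedUnder is decidable, so certificates are checked by evaluation.
inRange? : ∀ n v → Dec (InRange n v)
inRange? n v = (1 ≤? v) ×-dec (v ≤? n)

solvedUnder? : ∀ {k} n ρ (xs : Vec ℕ k) y → Dec (SolvedUnder n ρ xs y)
solvedUnder? {k} n ρ xs y =
  inRange? n y ×-dec ¬? (sameColour y nothing) ×-dec (sumFin k (lookup xs) ≟ 3 * y)
  ×-dec all? (λ i → inRange? n (lookup xs i) ×-dec sameColour (lookup xs i) (colourIn ρ y))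
  where sameColour : ∀ v b → Dec (colourIn ρ v ≡ b)
        sameColour v b = ≡-dec _≟ᴮ_ (colourIn ρ v) b

Valid : ∀ {k} → ℕ → Assignment → Certificate k → Set
Valid n ρ (solved xs y)  = True (solvedUnder? n ρ xs y)
Valid n ρ (split v t f)  = Valid n ((v , true) ∷ ρ) t × Valid n ((v , false) ∷ ρ) f

solved-sound : ∀ {k n c} ρ (xs : Vec ℕ k) y → Extends c ρ → SolvedUnder n ρ xs y
             → Σ (Solution k n) (Monochromatic c)
solved-sound ρ xs y ext (y∈ , fixed , eqn , xs-ok) =
  record { xs = lookup xs ; y = y ; xs∈ = λ i → proj₁ (xs-ok i) ; y∈ = y∈ ; eqn = eqn }
  , λ i → extends-agree {ρ = ρ} ext fixed (proj₂ (xs-ok i))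

valid-sound : ∀ {k n} (c : Coloring) ρ (tree : Certificate k) → Extends c ρ → Valid n ρ tree
            → Σ (Solution k n) (Monochromatic c)
valid-sound c ρ (solved xs y) ext valid = solved-sound ρ xs y ext (toWitness valid)
valid-sound c ρ (split v t f) ext (valid-t , valid-f) with c v in cv
... | true  = valid-sound c _ t (subst (λ b → Extends c ((v , b) ∷ ρ)) cv (extends-∷ {ρ = ρ} v ext)) valid-t
... | false = valid-sound c _ f (subst (λ b → Extends c ((v , b) ∷ ρ)) cv (extends-∷ {ρ = ρ} v ext)) valid-f

certificate-rado : ∀ {k n} (tree : Certificate k) → Valid n [] tree → RadoProperty (suc k) n
certificate-rado tree valid c = valid-sound c [] tree (λ _ _ ()) valid

representable : Coloring → Bool → ℕ → ℕ → ℕ → Bool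
representable c b N zero    s = s ≡ᵇ 0
representable c b N (suc k) s = ⌊ anyUpTo? firstTerm? (suc N) ⌋
  where firstTerm? : ∀ v → Dec (1 ≤ v × c v ≡ b × v ≤ s × T (representable c b N k (s ∸ v)))
        firstTerm? v = (1 ≤? v) ×-dec (c v ≟ᴮ b) ×-dec (v ≤? s) ×-dec T? (representable c b N k (s ∸ v))

representable-complete : ∀ c b N k (xs : Fin k → ℕ) → (∀ i → InRange N (xs i))
                       → (∀ i → c (xs i) ≡ b) → T (representable c b N k (sumFin k xs))
representable-complete c b N zero    xs range colour = _
representable-complete c b N (suc k) xs range colour =
  fromWitness (xs zero , s≤s (proj₂ (range zero)) , proj₁ (range zero) , colour zero
              , m≤m+n (xs zero) rest , subst (T ∘ representable c b N k) (sym (m+n∸m≡n (xs zero) rest)) rest-ok)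
  where rest : ℕ
        rest = sumFin k (xs ∘ suc)
        rest-ok : T (representable c b N k rest)
        rest-ok = representable-complete c b N k (xs ∘ suc) (range ∘ suc) (colour ∘ suc)

noTriple? : ∀ c N k → Dec (∀ {y} → y < suc N → ¬ T (representable c (c y) N k (3 * y)))
noTriple? c N k = allUpTo? (λ y → ¬? (T? (representable c (c y) N k (3 * y)))) (suc N)

exhaustive-noSolution : ∀ c N k n → n ≤ N → True (noTriple? c N k) → ¬ RadoProperty (suc k) n
exhaustive-noSolution c N k n n≤N check rado with rado c
... | s , mono = toWitness check (s≤s (≤-trans y≤n n≤N)) monochromatic-triple
  where
    open Solution s
    y≤n : y ≤ n
    y≤n = proj₂ y∈
    monochromatic-triple : T (representable c (c y) N k (3 * y))
    monochromatic-triple = subst (T ∘ representable c (c y) N k) eqn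
      (representable-complete c (c y) N k xs (λ i → proj₁ (xs∈ i) , ≤-trans (proj₂ (xs∈ i)) n≤N) mono)

-- The colouring of 1, 2, … by a list (false beyond its end).
listColouring : List Bool → Coloring
listColouring bs         zero          = false
listColouring []         (suc v)       = false
listColouring (b ∷ bs)   (suc zero)    = b
listColouring (b ∷ bs)   (suc (suc v)) = listColouring bs (suc v)

certificate-3 : Certificate 2
certificate-3 =
  (split 1
    (split 2
      (solved (1 ∷ 2 ∷ []) 1)
      (split 3
        (split 4
          (split 5
            (solved (4 ∷ 5 ∷ []) 3)
            (split 6
              (solved (3 ∷ 6 ∷ []) 3)
              (split 7
                (split 8
                  (solved (4 ∷ 8 ∷ []) 4)
                  (split 9
                    (solved (3 ∷ 9 ∷ []) 4)
                    (solved (9 ∷ 9 ∷ []) 6)))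
                (split 8
                  (solved (4 ∷ 8 ∷ []) 4)
                  (solved (7 ∷ 8 ∷ []) 5)))))
          (solved (2 ∷ 4 ∷ []) 2))
        (solved (3 ∷ 3 ∷ []) 2)))
    (split 2
      (split 3
        (solved (3 ∷ 3 ∷ []) 2)
        (split 4
          (solved (2 ∷ 4 ∷ []) 2)
          (split 5
            (split 6
              (split 7
                (split 8
                  (solved (7 ∷ 8 ∷ []) 5)
                  (solved (4 ∷ 8 ∷ []) 4))
                (split 8
                  (split 9
                    (solved (9 ∷ 9 ∷ []) 6)
                    (solved (3 ∷ 9 ∷ []) 4))
                  (solved (4 ∷ 8 ∷ []) 4)))
              (solved (3 ∷ 6 ∷ []) 3))
            (solved (4 ∷ 5 ∷ []) 3))))
      (solved (1 ∷ 2 ∷ []) 1)))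

certificate-5 : Certificate 4
certificate-5 =
  (split 1
    (split 2
      (solved (1 ∷ 1 ∷ 2 ∷ 2 ∷ []) 2)
      (split 3
        (split 4
          (solved (3 ∷ 3 ∷ 3 ∷ 3 ∷ []) 4)
          (solved (2 ∷ 2 ∷ 4 ∷ 4 ∷ []) 4))
        (solved (2 ∷ 2 ∷ 2 ∷ 3 ∷ []) 3)))
    (split 2
      (split 3
        (solved (2 ∷ 2 ∷ 2 ∷ 3 ∷ []) 3)
        (split 4
          (solved (2 ∷ 2 ∷ 4 ∷ 4 ∷ []) 4)
          (solved (3 ∷ 3 ∷ 3 ∷ 3 ∷ []) 4)))
      (solved (1 ∷ 1 ∷ 2 ∷ 2 ∷ []) 2)))

certificate-6 : Certificate 5
certificate-6 =
  (split 1
    (split 2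
      (solved (1 ∷ 1 ∷ 1 ∷ 1 ∷ 2 ∷ []) 2)
      (split 3
        (solved (1 ∷ 1 ∷ 1 ∷ 3 ∷ 3 ∷ []) 3)
        (split 4
          (split 5
            (solved (1 ∷ 1 ∷ 1 ∷ 4 ∷ 5 ∷ []) 4)
            (solved (3 ∷ 3 ∷ 3 ∷ 3 ∷ 3 ∷ []) 5))
          (solved (2 ∷ 2 ∷ 2 ∷ 2 ∷ 4 ∷ []) 4))))
    (split 2
      (split 3
        (split 4
          (solved (2 ∷ 2 ∷ 2 ∷ 2 ∷ 4 ∷ []) 4)
          (split 5
            (solved (3 ∷ 3 ∷ 3 ∷ 3 ∷ 3 ∷ []) 5)
            (solved (1 ∷ 1 ∷ 1 ∷ 4 ∷ 5 ∷ []) 4)))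
        (solved (1 ∷ 1 ∷ 1 ∷ 3 ∷ 3 ∷ []) 3))
      (solved (1 ∷ 1 ∷ 1 ∷ 1 ∷ 2 ∷ []) 2)))

certificate-7 : Certificate 6
certificate-7 =
  (split 1
    (split 2
      (solved (1 ∷ 1 ∷ 1 ∷ 1 ∷ 1 ∷ 1 ∷ []) 2)
      (split 3
        (split 4
          (solved (1 ∷ 1 ∷ 1 ∷ 1 ∷ 4 ∷ 4 ∷ []) 4)
          (solved (2 ∷ 2 ∷ 2 ∷ 2 ∷ 2 ∷ 2 ∷ []) 4))
        (split 4
          (solved (1 ∷ 1 ∷ 1 ∷ 1 ∷ 4 ∷ 4 ∷ []) 4)
          (solved (2 ∷ 2 ∷ 2 ∷ 2 ∷ 2 ∷ 2 ∷ []) 4))))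
    (split 2
      (split 3
        (split 4
          (solved (2 ∷ 2 ∷ 2 ∷ 2 ∷ 2 ∷ 2 ∷ []) 4)
          (solved (1 ∷ 1 ∷ 1 ∷ 1 ∷ 4 ∷ 4 ∷ []) 4))
        (split 4
          (solved (2 ∷ 2 ∷ 2 ∷ 2 ∷ 2 ∷ 2 ∷ []) 4)
          (solved (1 ∷ 1 ∷ 1 ∷ 1 ∷ 4 ∷ 4 ∷ []) 4)))
      (solved (1 ∷ 1 ∷ 1 ∷ 1 ∷ 1 ∷ 1 ∷ []) 2)))

-- m = 8 + 3u + ρ: the bounds of `threshold-noSolution` and `UpperBound` meet at C(m,3).
rado-large : ∀ u ρ → ρ ≤ 2 → IsRadoNumber (8 + (3 * u + ρ)) (C3 (8 + (3 * u + ρ)))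
rado-large u ρ ρ≤2 =
  subst (IsRadoNumber (8 + (3 * u + ρ))) (sym C3≡C)
    ( positive-third (proj₁ bounds)
    , UpperBound.monochromatic u ρ C ρ≤2 (proj₁ bounds) (proj₂ bounds)
    , λ n _ n<C → threshold-noSolution k t C n (≤-from-sum (identity u ρ)) (proj₂ bounds) n<C )
  where
    k t C : ℕ
    k = 7 + (3 * u + ρ)
    t = 3 + u
    C = ⌈ k * t /3⌉
    C3≡C : C3 (8 + (3 * u + ρ)) ≡ C
    C3≡C = cong (λ t → ⌈ k * t /3⌉) (ceil3-summands u ρ ρ≤2)
    bounds : k * t ≤ 3 * C × 3 * C ≤ k * t + 2
    bounds = ceil3-bounds (k * t)
    positive-third : ∀ {D} → k * t ≤ 3 * D → 1 ≤ D
    positive-third {zero}  ()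
    positive-third {suc D} _ = s≤s z≤n
    identity : ∀ u ρ → 3 * (3 + u) + ρ ≡ 7 + (3 * u + ρ) + 2
    identity = solve-∀

-- m = 7: C(7,3) = 4, with t = 2.
rado-seven : IsRadoNumber 7 4
rado-seven = s≤s z≤n , certificate-rado certificate-7 _
           , λ n _ n<4 → threshold-noSolution 6 2 4 n (≤-from-sum {d = 2} refl) (≤-from-sum {d = 2} refl) n<4

rado-from-seven : (m : ℕ) → 7 ≤ m → IsRadoNumber m (C3 m)
rado-from-seven m 7≤m with m≤n⇒∃[o]m+o≡n 7≤m
... | zero  , refl = rado-seven
... | suc j , refl with divMod3 j
...   | ρ≤2 , j≡ρ+3u = subst (λ m → IsRadoNumber m (C3 m)) (cong (8 +_) (trans (+-comm _ (j % 3)) (sym j≡ρ+3u)))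
                             (rado-large (j / 3) (j % 3) ρ≤2)

rado-six : IsRadoNumber 6 5
rado-six = s≤s z≤n , certificate-rado certificate-6 _
         , λ n _ n<5 → exhaustive-noSolution (listColouring (true ∷ false ∷ false ∷ true ∷ [])) 4 5 n (s≤s⁻¹ n<5) _

rado-five : IsRadoNumber 5 4
rado-five = s≤s z≤n , certificate-rado certificate-5 _
          , λ n _ n<4 → exhaustive-noSolution (listColouring (true ∷ false ∷ true ∷ [])) 3 4 n (s≤s⁻¹ n<4) _

rado-four : IsRadoNumber 4 1
rado-four = s≤s z≤n , ones , λ n 1≤n n<1 → ⊥-elim (<-irrefl refl (≤-trans 1≤n (s≤s⁻¹ n<1)))
  where ones : RadoProperty 4 1
        ones c = record { xs = λ _ → 1 ; y = 1 ; xs∈ = λ _ → ≤-refl , ≤-refl ; y∈ = ≤-refl , ≤-refl ; eqn = refl }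
               , λ _ → refl

rado-three : IsRadoNumber 3 9
rado-three = s≤s z≤n , certificate-rado certificate-3 _
           , λ n _ n<9 → exhaustive-noSolution (listColouring (true ∷ false ∷ true ∷ true ∷ false ∷ false ∷ true ∷ false ∷ [])) 8 2 n (s≤s⁻¹ n<9) _

theorem2 : ((m : ℕ) → 7 ≤ m → IsRadoNumber m (C3 m))
    × IsRadoNumber 6 5 × IsRadoNumber 5 4 × IsRadoNumber 4 1 × IsRadoNumber 3 9
theorem2 = rado-from-seven , rado-six , rado-five , rado-four , rado-three
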